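{- Let $\mathcal{A}$ be a finite set of integral affinographic hyperplanes in $\mathbb{R}^n$ with integral gain graph $\Phi$, and for each coordinate $i$ let $L_i\subset\mathbb{Z}$ be a finite list. Then the number of lattice points in $L_1\times\cdots\times L_n$ not lying in any hyperplane of $\mathcal{A}$ equals $$\sum_{B\subseteq E\text{ balanced}}(-1)^{|B|}\prod_{B_k}\Big|\bigcap_{v_i\in V(B_k)}\big(L_i+\varphi(B_{v_it_k})\big)\Big|,$$ where the product is over all connected components $B_k$ of the spanning subgraph $(V,B)$, $V(B_k)$ is the vertex set of $B_k$, $t_k$ is a top vertex of $B_k$, and $L_i+g$ is the translate of $L_i$ by $g$.
   Context: An integral affinographic hyperplane is a hyperplane $x_j=x_i+a$ with $i\ne j$, $a\in\mathbb{Z}$. The integral gain graph $\Phi$ of $\mathcal{A}$ has vertex set $V=\{v_1,\dots,v_n\}$ and, for each hyperplane $x_j=x_i+a$ in $\mathcal{A}$, an edge from $v_i$ to $v_j$ with gain $a$ (gain $-a$ in the reverse direction); $E$ is its edge set and path gains are sums of edge gains. An edge set $B$ is balanced if every circle in it has gain $0$; then all paths $B_{vw}$ in $B$ from $v$ to $w$ have the same gain $\varphi(B_{vw})$. A top vertex of a component of balanced $B$ is a vertex $t$ such that no path in that component ending at $t$ has negative gain. -}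

module Defs where

open import Data.Nat as ℕ using (ℕ; zero; suc)
open import Data.Integer as ℤ using (ℤ; +_; -_; _+_; _*_; _≤_)
open import Data.Bool using (Bool; true; false; if_then_else_)
open import Data.Fin using (Fin; zero; suc; _≟_)
open import Data.Fin.Subset using (Subset; _∈_; ∣_∣)
open import Data.Fin.Properties using (all?)
open import Data.List using (List; []; _∷_; map; filter; length; foldr; allFin; concatMap)
import Data.List as List
open import Data.Nat.ListAction using (product)
open import Data.List.Relation.Unary.Unique.Propositional using (Unique)
open import Data.List.Relation.Unary.All using (All)
import Data.List.Relation.Unary.All as All
open import Data.List.Membership.DecPropositional ℤ._≟_ using (_∈?_)
open import Data.Vec using (Vec; []; _∷_)
open import Data.Product using (Σ; ∃; ∃-syntax; _×_; _,_; proj₁; proj₂)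
open import Data.Sum using (_⊎_)
open import Relation.Binary.PropositionalEquality using (_≡_; _≢_)
open import Relation.Nullary using (Dec; yes; no; ¬_; ¬?)
open import Function.Bundles using (_⇔_)

-- The record  h  stands for the hyperplane  x_(tgt h) = x_(src h) + gain h,
-- with src h ≠ tgt h.  In the gain graph it is an edge from v_(src h) to
-- v_(tgt h) with gain (gain h)  (gain - gain h in the reverse direction).

record Hyp (n : ℕ) : Set where
  constructor hyp
  field
    src      : Fin n
    tgt      : Fin n
    gain     : ℤ
    distinct : src ≢ tgt
open Hyp public

SameHyp : ∀ {n} → Hyp n → Hyp n → Set
SameHyp h h′ =
  (src h ≡ src h′ × tgt h ≡ tgt h′ × gain h ≡ gain h′)
  ⊎ (src h ≡ tgt h′ × tgt h ≡ src h′ × gain h ≡ - gain h′)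

OnHyp : ∀ {n} → (Fin n → ℤ) → Hyp n → Set
OnHyp x h = x (tgt h) ≡ x (src h) + gain h

onHyp? : ∀ {n} (x : Fin n → ℤ) (h : Hyp n) → Dec (OnHyp x h)
onHyp? x h = x (tgt h) ℤ.≟ (x (src h) + gain h)

-- The gain graph Φ of an arrangement  H : Fin m → Hyp n :
-- vertex set Fin n, edge set Fin m (edge e comes from hyperplane H e).
-- Edge subsets B ⊆ E are  Subset m.

module GainGraph {n m : ℕ} (H : Fin m → Hyp n) where

  -- An oriented edge: (e , true) traverses e from src to tgt,
  -- (e , false) traverses it from tgt to src.
  Step : Set
  Step = Fin m × Bool

  edge : Step → Fin m
  edge = proj₁

  from : Step → Fin n
  from (e , true)  = src (H e)
  from (e , false) = tgt (H e)

  to : Step → Fin n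
  to (e , true)  = tgt (H e)
  to (e , false) = src (H e)

  stepGain : Step → ℤ
  stepGain (e , true)  = gain (H e)
  stepGain (e , false) = - gain (H e)

  gainOf : List Step → ℤ
  gainOf = foldr (λ s g → stepGain s + g) (+ 0)

  data IsWalk (B : Subset m) : Fin n → List Step → Fin n → Set where
    nil  : ∀ {v} → IsWalk B v [] v
    cons : ∀ {v w s ss} → edge s ∈ B → from s ≡ v →
           IsWalk B (to s) ss w → IsWalk B v (s ∷ ss) w

  IsPath : Subset m → Fin n → List Step → Fin n → Set
  IsPath B v ss w = IsWalk B v ss w × Unique (v ∷ map to ss)

  IsCircle : Subset m → Fin n → List Step → Set
  IsCircle B v ss = IsWalk B v ss v × ss ≢ [] ×
                    Unique (map to ss) × Unique (map edge ss)

  Balanced : Subset m → Set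
  Balanced B = ∀ v ss → IsCircle B v ss → gainOf ss ≡ + 0

  Connected : Subset m → Fin n → Fin n → Set
  Connected B v w = ∃[ ss ] IsPath B v ss w

  -- Data describing the connected components B_1 … B_c of the spanning
  -- subgraph (V , B) of a balanced B, a top vertex t_k of each B_k, and
  -- for each vertex v the gain φ v = φ(B_{v t_k}) of a path in B from v
  -- to the top vertex of its component.
  record Components (B : Subset m) : Set where
    field
      c        : ℕ
      comp     : Fin n → Fin c
      comp-iff : ∀ v w → (comp v ≡ comp w) ⇔ Connected B v w
      comp-sur : ∀ k → ∃[ v ] comp v ≡ k
      top      : Fin c → Fin n
      top-in   : ∀ k → comp (top k) ≡ k
      top-top  : ∀ k v ss → comp v ≡ k → IsPath B v ss (top k) → + 0 ≤ gainOf ss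
      φ        : Fin n → ℤ
      φ-gain   : ∀ v → ∃[ ss ] (IsPath B v ss (top (comp v)) × gainOf ss ≡ φ v)

-- Finite sets of integers are represented by duplicate-free lists.

_⊕_ : List ℤ → ℤ → List ℤ
L ⊕ g = map (_+ g) L

-- intersection of a nonempty finite family of finite sets
-- (the empty family never occurs below, since components are nonempty)
⋂ : List (List ℤ) → List ℤ
⋂ []       = []
⋂ (L ∷ Ls) = filter (λ z → All.all? (z ∈?_) Ls) L

points : (n : ℕ) → (Fin n → List ℤ) → List (Fin n → ℤ)
points zero    L = (λ ()) ∷ []
points (suc n) L =
  concatMap (λ z → map (λ x → λ { zero → z ; (suc i) → x i }) (points n (λ i → L (suc i))))
            (L zero)

count : ∀ {n m} → (Fin m → Hyp n) → (Fin n → List ℤ) → ℕ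
count {n} H L =
  length (filter (λ x → all? (λ e → ¬? (onHyp? x (H e)))) (points n L))

subsets : (m : ℕ) → List (Subset m)
subsets zero    = [] ∷ []
subsets (suc m) = concatMap (λ S → (true ∷ S) ∷ (false ∷ S) ∷ []) (subsets m)

sumℤ : List ℤ → ℤ
sumℤ = foldr _+_ (+ 0)

module _ {n m : ℕ} (H : Fin m → Hyp n) where
  open GainGraph H

  componentProduct : (L : Fin n → List ℤ) {B : Subset m} → Components B → ℕ
  componentProduct L D =
    product (map (λ k → length (⋂ (map (λ v → L v ⊕ φ v)
                                          (filter (λ v → comp v ≟ k) (allFin n)))))
                      (allFin c))
    where open Components D

  rhs : (L : Fin n → List ℤ) →
        (bal? : ∀ B → Dec (Balanced B)) →
        (D : ∀ B → Balanced B → Components B) → ℤ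
  rhs L bal? D = sumℤ (map term (subsets m))
    where
      term : Subset m → ℤ
      term B with bal? B
      ... | yes b = (ℤ.- (+ 1)) ℤ.^ ∣ B ∣ * + componentProduct L (D B b)
      ... | no _  = + 0

module Submission where

-- Inclusion–exclusion over edge sets B ⊆ E writes the count as Σ_B (-1)^|B| N(B), where N(B)
-- counts the points of L₁ × ⋯ × Lₙ lying on every hyperplane of B.  Along a walk in B such a
-- point changes by the gain of the walk, so N(B) = 0 unless B is balanced.  In a balanced B the
-- gain of a walk depends only on its ends (a closed walk shortcuts into circles and retraced
-- edges), so a point on B is determined by its values at the chosen vertices t_k through
-- x_v = x_(t_k) − φ(v), and x_(t_k) ranges exactly over ⋂_(v ∈ B_k) (L_v + φ(v)).  Nothing uses
-- that t_k is a top vertex: any base vertex of each component gives the same product.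

open import Defs
open import Level using (0ℓ)
open import Function using (_∘_; id)
open import Function.Bundles using (Equivalence)
open import Data.Empty using (⊥-elim)
open import Data.Product using (_×_; _,_; proj₁; proj₂; ∃-syntax; Σ-syntax)
open import Data.Sum using (_⊎_; inj₁; inj₂)
open import Data.Bool using (true; false; not)
open import Data.Nat as ℕ using (ℕ; zero; suc; _≤_; z≤n; s≤s)
import Data.Nat.Properties as ℕ
open import Data.Integer as ℤ using (ℤ; +_; -_; _+_; _*_; _-_)
import Data.Integer.Properties as ℤ
open import Data.Integer.Tactic.RingSolver using (solve-∀)
open import Algebra.Properties.AbelianGroup ℤ.+-0-abelianGroup
  using (x≈z//y; identityʳ-unique; x∙y⁻¹≈ε⇒x≈y; ∙-cancelʳ)
open import Algebra.Properties.CommutativeSemigroup ℤ.+-commutativeSemigroup using (interchange)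
open import Data.Fin as Fin using (Fin; zero; suc; _≟_)
open import Data.Fin.Properties using (all?)
open import Data.Fin.Subset using (Subset; ∣_∣) renaming (_∈_ to _∈ₑ_)
import Data.Fin.Subset.Properties as Subset
open import Data.Vec using (_∷_; here; there)
open import Data.List
  using (List; []; _∷_; _++_; map; filter; allFin; concatMap; length; tabulate; cartesianProductWith)
open import Data.List.Properties
  using (map-cong; map-++; map-tabulate; filter-none; length-++; length-map; length-removeAt′)
open import Data.Nat.ListAction using (product)
open import Data.List.Relation.Unary.All as All using (All; []; _∷_)
import Data.List.Relation.Unary.All.Properties as All
open import Data.List.Relation.Unary.All.Properties using (All¬⇒¬Any; ¬Any⇒All¬)
open import Data.List.Relation.Unary.Any as Any using (Any; here; there; index)
open import Data.List.Relation.Unary.AllPairs using ([]; _∷_)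
open import Data.List.Relation.Unary.Unique.Propositional using (Unique)
import Data.List.Relation.Unary.Unique.Propositional.Properties as Unique
open import Data.List.Relation.Unary.Unique.Setoid using () renaming (Unique to Unique[_])
import Data.List.Relation.Unary.Unique.Setoid.Properties as UniqueSetoid
open import Data.List.Membership.Propositional using (_∈_)
open import Data.List.Membership.Propositional.Properties
  using (∈-map⁺; ∈-map⁻; ∈-filter⁺; ∈-filter⁻; ∈-allFin)
import Data.List.Membership.Setoid as Membership
import Data.List.Membership.Setoid.Properties as Membershipₚ
import Data.List.Membership.DecPropositional as DecMembership
open import Relation.Binary.Bundles using (Setoid)
open import Relation.Binary.PropositionalEquality as ≡
  using (_≡_; _≢_; refl; sym; trans; cong; cong₂; subst)
open import Data.Vec.Functional.Relation.Binary.Equality.Setoid (≡.setoid ℤ)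
  using (_≋_; ≋-setoid; ≋-reflexive)
open import Relation.Unary using (Pred; Decidable)
open import Relation.Nullary using (Dec; yes; no; ¬_; ¬?)
open import Relation.Nullary.Decidable using (_→-dec_)

module _ {a ℓ} (S : Setoid a ℓ) where
  open Setoid S using (_≉_) renaming (sym to ≈-sym; trans to ≈-trans)
  open Membership S using (_─_) renaming (_∈_ to _∈ₛ_)

  ∈-─⁺ : ∀ {x y ys} (y∈ : y ∈ₛ ys) → x ∈ₛ ys → x ≉ y → x ∈ₛ ys ─ y∈
  ∈-─⁺ (here y≈) (here x≈) x≉y = ⊥-elim (x≉y (≈-trans x≈ (≈-sym y≈)))
  ∈-─⁺ (here _)  (there x∈) _   = x∈
  ∈-─⁺ (there _) (here x≈) _    = here x≈
  ∈-─⁺ (there y∈) (there x∈) x≉y = there (∈-─⁺ y∈ x∈ x≉y)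

  unique⇒length≤ : ∀ {xs ys} → Unique[ S ] xs → All (_∈ₛ ys) xs → length xs ≤ length ys
  unique⇒length≤ [] [] = z≤n
  unique⇒length≤ {x ∷ xs} {ys} (x∉ ∷ xs!) (x∈ ∷ xs⊆) =
    ℕ.≤-trans (s≤s (unique⇒length≤ xs! xs⊆ys─x))
              (ℕ.≤-reflexive (sym (length-removeAt′ ys (index x∈))))
    where
    xs⊆ys─x : All (_∈ₛ ys ─ x∈) xs
    xs⊆ys─x = All.zipWith (λ (y∈ , x≉y) → ∈-─⁺ x∈ y∈ (x≉y ∘ ≈-sym)) (xs⊆ , x∉)

module _ {a b ℓ₁ ℓ₂ p} (S : Setoid a ℓ₁) (T : Setoid b ℓ₂) {P : Pred (Setoid.Carrier S) p}
         (f : Setoid.Carrier S → Setoid.Carrier T) where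
  open Setoid S using () renaming (_≈_ to _≈₁_)
  open Setoid T using () renaming (_≈_ to _≈₂_)
  open Membership T using () renaming (_∈_ to _∈₂_)

  unique-map⁺ : (∀ {x y} → P x → P y → f x ≈₂ f y → x ≈₁ y) →
                ∀ {xs} → All P xs → Unique[ S ] xs → Unique[ T ] (map f xs)
  unique-map⁺ inj [] [] = []
  unique-map⁺ inj (px ∷ pxs) (x∉ ∷ xs!) =
    All.map⁺ {f = f} (All.zipWith (λ (py , x≉y) → x≉y ∘ inj px py) (pxs , x∉))
      ∷ unique-map⁺ inj pxs xs!

  length≤-injectiveOn : (∀ {x y} → P x → P y → f x ≈₂ f y → x ≈₁ y) →
                        ∀ {xs ys} → Unique[ S ] xs → All P xs →
                        (∀ {x} → P x → f x ∈₂ ys) → length xs ≤ length ys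
  length≤-injectiveOn inj {xs} {ys} xs! pxs f∈ =
    subst (_≤ length ys) (length-map f xs)
      (unique⇒length≤ T (unique-map⁺ inj pxs xs!) (All.map⁺ (All.map f∈ pxs)))

concatMap-map≡cartesianProductWith : ∀ {A B C : Set} (f : A → B → C) xs ys →
  concatMap (λ x → map (f x) ys) xs ≡ cartesianProductWith f xs ys
concatMap-map≡cartesianProductWith f []       ys = refl
concatMap-map≡cartesianProductWith f (x ∷ xs) ys =
  cong (map (f x) ys ++_) (concatMap-map≡cartesianProductWith f xs ys)

length-cartesianProductWith : ∀ {A B C : Set} (f : A → B → C) xs ys →
  length (cartesianProductWith f xs ys) ≡ length xs ℕ.* length ys
length-cartesianProductWith f []       ys = refl
length-cartesianProductWith f (x ∷ xs) ys = trans (length-++ (map (f x) ys))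
  (cong₂ ℕ._+_ (length-map (f x) ys) (length-cartesianProductWith f xs ys))

∈-points⁻ : ∀ n L {x} → Any (x ≋_) (points n L) → ∀ i → x i ∈ L i
∈-points⁻ (suc n) L {x} x∈ i
  with Membershipₚ.∈-cartesianProductWith⁻ (≡.setoid ℤ) (≋-setoid n) (≋-setoid (suc n)) _ (L zero) _
         (subst (Any (x ≋_)) (concatMap-map≡cartesianProductWith _ (L zero) _) x∈)
... | z , y , z∈ , y∈ , x≋ with i
...   | zero  = subst (_∈ L zero) (sym (x≋ zero)) z∈
...   | suc j = subst (_∈ L (suc j)) (sym (x≋ (suc j))) (∈-points⁻ n (L ∘ suc) y∈ j)

∈-points⁺ : ∀ n L {x} → (∀ i → x i ∈ L i) → Any (x ≋_) (points n L)
∈-points⁺ zero    L x∈ = here (λ ())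
∈-points⁺ (suc n) L {x} x∈ =
  subst (Any (x ≋_)) (sym (concatMap-map≡cartesianProductWith _ (L zero) _))
    (Membershipₚ.∈-resp-≈ (≋-setoid (suc n)) (λ { zero → refl ; (suc i) → refl })
      (Membershipₚ.∈-cartesianProductWith⁺ (≡.setoid ℤ) (≋-setoid n) (≋-setoid (suc n))
        (λ { refl y≋ zero → refl ; refl y≋ (suc i) → y≋ i })
        (x∈ zero) (∈-points⁺ n (L ∘ suc) (x∈ ∘ suc))))

points-unique : ∀ n L → (∀ i → Unique (L i)) → Unique[ ≋-setoid n ] (points n L)
points-unique zero    L L! = [] ∷ []
points-unique (suc n) L L! =
  subst (Unique[ ≋-setoid (suc n) ]) (sym (concatMap-map≡cartesianProductWith _ (L zero) _))
    (UniqueSetoid.cartesianProductWith⁺ (≡.setoid ℤ) (≋-setoid n) (≋-setoid (suc n)) _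
      (λ e → e zero , e ∘ suc) (L! zero) (points-unique n (L ∘ suc) (L! ∘ suc)))

length-points : ∀ n L → length (points n L) ≡ product (tabulate (length ∘ L))
length-points zero    L = refl
length-points (suc n) L = begin
  length (points (suc n) L)
    ≡⟨ cong length (concatMap-map≡cartesianProductWith _ (L zero) _) ⟩
  length (cartesianProductWith _ (L zero) (points n (L ∘ suc)))
    ≡⟨ length-cartesianProductWith _ (L zero) _ ⟩
  length (L zero) ℕ.* length (points n (L ∘ suc))
    ≡⟨ cong (length (L zero) ℕ.*_) (length-points n (L ∘ suc)) ⟩
  product (tabulate (length ∘ L)) ∎
  where open ≡.≡-Reasoning

∈-⋂⁺ : ∀ {z L Ls} → L ∈ Ls → All (z ∈_) Ls → z ∈ ⋂ Ls
∈-⋂⁺ {Ls = _ ∷ _} _ (z∈L ∷ z∈Ls) = ∈-filter⁺ _ z∈L z∈Ls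

∈-⋂⁻ : ∀ {z} Ls → z ∈ ⋂ Ls → All (z ∈_) Ls
∈-⋂⁻ (_ ∷ _) z∈ = let z∈L , z∈Ls = ∈-filter⁻ _ z∈ in z∈L ∷ z∈Ls

⋂-unique : ∀ {Ls} → All Unique Ls → Unique (⋂ Ls)
⋂-unique []        = []
⋂-unique (L! ∷ _) = Unique.filter⁺ _ L!

⊕-unique : ∀ {L} g → Unique L → Unique (L ⊕ g)
⊕-unique g = Unique.map⁺ (λ {x} {y} → ∙-cancelʳ g x y)

indicator : ∀ {A : Set} → Dec A → ℕ
indicator (yes _) = 1
indicator (no _)  = 0

indicator-cong : ∀ {A B : Set} → (A → B) → (B → A) → (a? : Dec A) (b? : Dec B) →
                 indicator a? ≡ indicator b?
indicator-cong f g (yes _) (yes _) = refl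
indicator-cong f g (yes a) (no ¬b) = ⊥-elim (¬b (f a))
indicator-cong f g (no ¬a) (yes b) = ⊥-elim (¬a (g b))
indicator-cong f g (no _)  (no _)  = refl

indicator-no : ∀ {A : Set} → ¬ A → (a? : Dec A) → indicator a? ≡ 0
indicator-no ¬a a? = indicator-cong ¬a (λ ()) a? (no id)

length-filter-∷ : ∀ {A : Set} {P : Pred A 0ℓ} (P? : Decidable P) x xs →
                  length (filter P? (x ∷ xs)) ≡ indicator (P? x) ℕ.+ length (filter P? xs)
length-filter-∷ P? x xs with P? x
... | yes _ = refl
... | no _  = refl

sumℤ-map-zero : ∀ {A : Set} {f : A → ℤ} → (∀ x → f x ≡ + 0) → ∀ xs → sumℤ (map f xs) ≡ + 0
sumℤ-map-zero f≡0 []       = refl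
sumℤ-map-zero f≡0 (x ∷ xs) = cong₂ _+_ (f≡0 x) (sumℤ-map-zero f≡0 xs)

sumℤ-map-+ : ∀ {A : Set} (f g : A → ℤ) xs →
             sumℤ (map (λ x → f x + g x) xs) ≡ sumℤ (map f xs) + sumℤ (map g xs)
sumℤ-map-+ f g []       = refl
sumℤ-map-+ f g (x ∷ xs) =
  trans (cong (λ s → f x + g x + s) (sumℤ-map-+ f g xs)) (interchange (f x) (g x) _ _)

sign : ∀ {m} → Subset m → ℤ
sign B = (- (+ 1)) ℤ.^ ∣ B ∣

sumℤ-subsets-suc : ∀ {m} (f : Subset (suc m) → ℤ) →
  sumℤ (map f (subsets (suc m))) ≡ sumℤ (map (λ S → f (true ∷ S) + f (false ∷ S)) (subsets m))
sumℤ-subsets-suc {m} f = go (subsets m)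
  where
  go : ∀ Ss → sumℤ (map f (concatMap (λ S → (true ∷ S) ∷ (false ∷ S) ∷ []) Ss))
            ≡ sumℤ (map (λ S → f (true ∷ S) + f (false ∷ S)) Ss)
  go []       = refl
  go (S ∷ Ss) = trans (sym (ℤ.+-assoc (f (true ∷ S)) _ _))
                      (cong (λ s → f (true ∷ S) + f (false ∷ S) + s) (go Ss))

allIn? : ∀ {m} {P : Pred (Fin m) 0ℓ} → Decidable P → (B : Subset m) → Dec (∀ e → e ∈ₑ B → P e)
allIn? P? B = all? (λ e → (e Subset.∈? B) →-dec P? e)

alternating-sum : ∀ m {P : Pred (Fin m) 0ℓ} (P? : Decidable P) →
  sumℤ (map (λ B → sign B * + indicator (allIn? P? B)) (subsets m)) ≡ + indicator (all? (¬? ∘ P?))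
alternating-sum zero    P? = refl
alternating-sum (suc m) {P} P? = by-cases (P? zero)
  where
  open ≡.≡-Reasoning
  term : Subset (suc m) → ℤ
  term B = sign B * + indicator (allIn? P? B)
  by-cases : Dec (P zero) →
    sumℤ (map term (subsets (suc m))) ≡ + indicator (all? (¬? ∘ P?))
  by-cases (yes p₀) = begin
    sumℤ (map term (subsets (suc m)))
      ≡⟨ sumℤ-subsets-suc term ⟩
    sumℤ (map (λ S → term (true ∷ S) + term (false ∷ S)) (subsets m))
      ≡⟨ sumℤ-map-zero cancel (subsets m) ⟩
    + 0
      ≡⟨ cong +_ (indicator-no (λ none → none zero p₀) (all? (¬? ∘ P?))) ⟨
    + indicator (all? (¬? ∘ P?)) ∎
    where
    cancel : ∀ S → term (true ∷ S) + term (false ∷ S) ≡ + 0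
    cancel S = begin
      term (true ∷ S) + term (false ∷ S)
        ≡⟨ cong (λ k → sign (true ∷ S) * + k + term (false ∷ S)) zero-irrelevant ⟩
      - (+ 1) * sign S * + k + sign S * + k
        ≡⟨ opposite (sign S) (+ k) ⟩
      + 0 ∎
      where
      k = indicator (allIn? P? (false ∷ S))
      zero-irrelevant : indicator (allIn? P? (true ∷ S)) ≡ k
      zero-irrelevant = indicator-cong
        (λ { all (suc e) (there e∈) → all (suc e) (there e∈) })
        (λ { all zero here → p₀ ; all (suc e) (there e∈) → all (suc e) (there e∈) }) _ _
      opposite : ∀ s x → - (+ 1) * s * x + s * x ≡ + 0
      opposite = solve-∀
  by-cases (no ¬p₀) = begin
    sumℤ (map term (subsets (suc m)))
      ≡⟨ sumℤ-subsets-suc term ⟩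
    sumℤ (map (λ S → term (true ∷ S) + term (false ∷ S)) (subsets m))
      ≡⟨ cong sumℤ (map-cong drop-zero (subsets m)) ⟩
    sumℤ (map (λ S → sign S * + indicator (allIn? (P? ∘ suc) S)) (subsets m))
      ≡⟨ alternating-sum m (P? ∘ suc) ⟩
    + indicator (all? (¬? ∘ P? ∘ suc))
      ≡⟨ cong +_ (indicator-cong (λ { none zero → ¬p₀ ; none (suc e) → none e }) (_∘ suc) _ _) ⟩
    + indicator (all? (¬? ∘ P?)) ∎
    where
    drop-zero : ∀ S → term (true ∷ S) + term (false ∷ S) ≡ sign S * + indicator (allIn? (P? ∘ suc) S)
    drop-zero S = trans
      (cong₂ _+_
        (trans (cong (λ k → sign (true ∷ S) * + k) (indicator-no (λ all → ¬p₀ (all zero here)) _))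
               (ℤ.*-zeroʳ (sign (true ∷ S))))
        (cong (λ k → sign S * + k)
          (indicator-cong (λ all e e∈ → all (suc e) (there e∈))
                          (λ { all (suc e) (there e∈) → all e e∈ }) _ _)))
      (ℤ.+-identityˡ _)

module Walks {n m : ℕ} (H : Fin m → Hyp n) where
  open GainGraph H
  module EdgeList   = DecMembership (Fin._≟_ {m})
  module VertexList = DecMembership (Fin._≟_ {n})

  Satisfies : Subset m → (Fin n → ℤ) → Set
  Satisfies B x = ∀ e → e ∈ₑ B → OnHyp x (H e)

  reverseStep : Step → Step
  reverseStep (e , b) = e , not b

  from-reverseStep : ∀ s → from (reverseStep s) ≡ to s
  from-reverseStep (e , true)  = refl
  from-reverseStep (e , false) = refl

  to-reverseStep : ∀ s → to (reverseStep s) ≡ from s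
  to-reverseStep (e , true)  = refl
  to-reverseStep (e , false) = refl

  stepGain-reverseStep : ∀ s → stepGain (reverseStep s) ≡ - stepGain s
  stepGain-reverseStep (e , true)  = refl
  stepGain-reverseStep (e , false) = sym (ℤ.neg-involutive _)

  from≢to : ∀ s → from s ≢ to s
  from≢to (e , true)  = distinct (H e)
  from≢to (e , false) = distinct (H e) ∘ sym

  same-edge : ∀ s t → edge s ≡ edge t → t ≡ s ⊎ t ≡ reverseStep s
  same-edge (e , true)  (.e , true)  refl = inj₁ refl
  same-edge (e , true)  (.e , false) refl = inj₂ refl
  same-edge (e , false) (.e , true)  refl = inj₂ refl
  same-edge (e , false) (.e , false) refl = inj₁ refl

  gainOf-++ : ∀ ps qs → gainOf (ps ++ qs) ≡ gainOf ps + gainOf qs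
  gainOf-++ []       qs = sym (ℤ.+-identityˡ _)
  gainOf-++ (s ∷ ps) qs =
    trans (cong (λ g → stepGain s + g) (gainOf-++ ps qs)) (sym (ℤ.+-assoc (stepGain s) _ _))

  step-satisfies : ∀ {B} x → Satisfies B x → ∀ s → edge s ∈ₑ B →
                   x (to s) ≡ x (from s) + stepGain s
  step-satisfies x x⊨B (e , true)  e∈ = x⊨B e e∈
  step-satisfies x x⊨B (e , false) e∈ = x≈z//y _ _ _ (sym (x⊨B e e∈))

  walk-satisfies : ∀ {B v ss w} x → Satisfies B x → IsWalk B v ss w → x w ≡ x v + gainOf ss
  walk-satisfies x x⊨B nil = sym (ℤ.+-identityʳ _)
  walk-satisfies {w = w} x x⊨B (cons {s = s} {ss = ss} e∈ refl wk) = begin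
    x w                                 ≡⟨ walk-satisfies x x⊨B wk ⟩
    x (to s) + gainOf ss                ≡⟨ cong (_+ gainOf ss) (step-satisfies x x⊨B s e∈) ⟩
    x (from s) + stepGain s + gainOf ss ≡⟨ ℤ.+-assoc (x (from s)) (stepGain s) (gainOf ss) ⟩
    x (from s) + gainOf (s ∷ ss)        ∎
    where open ≡.≡-Reasoning

  satisfiable⇒balanced : ∀ {B} x → Satisfies B x → Balanced B
  satisfiable⇒balanced x x⊨B v ss (closed , _) =
    identityʳ-unique (x v) (gainOf ss) (sym (walk-satisfies x x⊨B closed))

  revAppend : List Step → List Step → List Step
  revAppend []       acc = acc
  revAppend (s ∷ ss) acc = revAppend ss (reverseStep s ∷ acc)

  walk-revAppend : ∀ {B a ps b acc c} → IsWalk B a ps b → IsWalk B a acc c →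
                   IsWalk B b (revAppend ps acc) c
  walk-revAppend nil wacc = wacc
  walk-revAppend {B} (cons {s = s} e∈ refl wk) wacc = walk-revAppend wk
    (cons e∈ (from-reverseStep s) (subst (λ v → IsWalk B v _ _) (sym (to-reverseStep s)) wacc))

  gainOf-revAppend : ∀ ps acc → gainOf (revAppend ps acc) ≡ gainOf acc - gainOf ps
  gainOf-revAppend []       acc = sym (ℤ.+-identityʳ _)
  gainOf-revAppend (s ∷ ss) acc = begin
    gainOf (revAppend ss (reverseStep s ∷ acc))
      ≡⟨ gainOf-revAppend ss (reverseStep s ∷ acc) ⟩
    stepGain (reverseStep s) + gainOf acc - gainOf ss
      ≡⟨ cong (λ g → g + gainOf acc - gainOf ss) (stepGain-reverseStep s) ⟩
    - stepGain s + gainOf acc - gainOf ss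
      ≡⟨ regroup (stepGain s) (gainOf acc) (gainOf ss) ⟩
    gainOf acc - (stepGain s + gainOf ss) ∎
    where
    open ≡.≡-Reasoning
    regroup : ∀ a b c → - a + b - c ≡ b - (a + c)
    regroup = solve-∀

  walk-[] : ∀ {B a b} → IsWalk B a [] b → a ≡ b
  walk-[] nil = refl

  from∈vertices : ∀ {B a ps b t} → IsWalk B a ps b → t ∈ ps → from t ∈ a ∷ map to ps
  from∈vertices (cons _ refl _)  (here refl) = here refl
  from∈vertices (cons _ refl wk) (there t∈)  = there (from∈vertices wk t∈)

  end∈vertices : ∀ {B a s ss b} → IsWalk B a (s ∷ ss) b → b ∈ map to (s ∷ ss)
  end∈vertices (cons _ _ nil)                = here refl
  end∈vertices (cons _ _ wk@(cons _ _ _)) = there (end∈vertices wk)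

  closed-path-empty : ∀ {B a ps} → IsPath B a ps a → ps ≡ []
  closed-path-empty {ps = []}    _              = refl
  closed-path-empty {ps = _ ∷ _} (wk , a∉ ∷ _) = ⊥-elim (All¬⇒¬Any a∉ (end∈vertices wk))

  path-edges-unique : ∀ {B a ps b} → IsPath B a ps b → Unique (map edge ps)
  path-edges-unique (nil , _) = []
  path-edges-unique (cons {s = s} {ss = ss} _ refl wk , a∉ ∷ vs!) =
    All.map⁺ (All.tabulate edge≢) ∷ path-edges-unique (wk , vs!)
    where
    edge≢ : ∀ {t} → t ∈ ss → edge s ≢ edge t
    edge≢ {t} t∈ eq with same-edge s t eq
    ... | inj₁ refl = All¬⇒¬Any a∉ (from∈vertices wk t∈)
    ... | inj₂ refl = All¬⇒¬Any a∉ (there (subst (_∈ _) (to-reverseStep s) (∈-map⁺ to t∈)))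

  path-first-step : ∀ {B a t₁ r b t} → IsPath B a (t₁ ∷ r) b → t ∈ t₁ ∷ r → from t ≡ a → t ≡ t₁
  path-first-step _                          (here t≡t₁) _ = t≡t₁
  path-first-step (cons _ refl wk , a∉ ∷ _) (there t∈)  t-from =
    ⊥-elim (All¬⇒¬Any a∉ (subst (_∈ _) t-from (from∈vertices wk t∈)))

  retracing-path-gain : ∀ {B s t₁ r t} → IsPath B (to s) (t₁ ∷ r) (from s) →
                        t ∈ t₁ ∷ r → edge s ≡ edge t → stepGain s + gainOf (t₁ ∷ r) ≡ + 0
  retracing-path-gain {s = s} {t = t} path t∈ same with same-edge s t same
  retracing-path-gain {s = s} (_ , to-s∉ ∷ _) t∈ _ | inj₁ refl =
    ⊥-elim (All¬⇒¬Any to-s∉ (∈-map⁺ to t∈))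
  retracing-path-gain {B} {s} {r = r} path@(cons _ _ wr , _ ∷ r-vs!) t∈ _ | inj₂ refl
    with path-first-step path t∈ (from-reverseStep s)
  ... | refl = begin
    stepGain s + (stepGain (reverseStep s) + gainOf r)
      ≡⟨ cong (λ q → stepGain s + (stepGain (reverseStep s) + gainOf q)) r≡[] ⟩
    stepGain s + (stepGain (reverseStep s) + + 0)
      ≡⟨ cong (λ g → stepGain s + g) (trans (ℤ.+-identityʳ _) (stepGain-reverseStep s)) ⟩
    stepGain s - stepGain s
      ≡⟨ ℤ.+-inverseʳ (stepGain s) ⟩
    + 0 ∎
    where
    open ≡.≡-Reasoning
    r≡[] : r ≡ []
    r≡[] = closed-path-empty (subst (λ v → IsWalk B v r (from s)) (to-reverseStep s) wr ,
                              subst (λ v → Unique (v ∷ map to r)) (to-reverseStep s) r-vs!)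

  -- Followed by a path back to its start, a step either closes a circle or
  -- is immediately retraced.
  balanced-step-path : ∀ {B s q} → Balanced B → edge s ∈ₑ B →
                       IsPath B (to s) q (from s) → stepGain s + gainOf q ≡ + 0
  balanced-step-path {s = s} {[]} _ _ (wq , _) = ⊥-elim (from≢to s (sym (walk-[] wq)))
  balanced-step-path {s = s} {q@(_ ∷ _)} bal e∈ path@(wq , vs!) with edge s EdgeList.∈? map edge q
  ... | no e∉   = bal (from s) (s ∷ q)
                    (cons e∈ refl wq , (λ ()) , vs! , ¬Any⇒All¬ _ e∉ ∷ path-edges-unique path)
  ... | yes e∈q = let _ , t∈ , same = ∈-map⁻ edge e∈q in retracing-path-gain {s = s} path t∈ same

  record PathSplit (B : Subset m) (u : Fin n) (ps : List Step) (v w : Fin n) : Set where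
    field
      prefix suffix : List Step
      ps≡           : ps ≡ prefix ++ suffix
      prefix-path   : IsPath B u prefix v
      suffix-path   : IsPath B v suffix w

  split-path : ∀ {B u ps v w} → IsPath B u ps w → v ∈ map to ps → PathSplit B u ps v w
  split-path (cons {s = s} {ss = ss} e∈ refl wk , u∉ ∷ vs!) (here refl) = record
    { prefix      = s ∷ []
    ; suffix      = ss
    ; ps≡         = refl
    ; prefix-path = cons e∈ refl nil , (All.head u∉ ∷ []) ∷ [] ∷ []
    ; suffix-path = wk , vs!
    }
  split-path {u = u} (cons {s = s} e∈ refl wk , u∉ ∷ vs!) (there v∈) = record
    { prefix      = s ∷ prefix
    ; suffix      = suffix
    ; ps≡         = cong (s ∷_) ps≡
    ; prefix-path = cons e∈ refl (proj₁ prefix-path) , u∉prefix ∷ proj₂ prefix-path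
    ; suffix-path = suffix-path
    }
    where
    open PathSplit (split-path (wk , vs!) v∈)
    u∉prefix : All (u ≢_) (map to (s ∷ prefix))
    u∉prefix = All.++⁻ˡ (map to (s ∷ prefix))
      (subst (All (u ≢_)) (trans (cong (map to ∘ (s ∷_)) ps≡) (map-++ to (s ∷ prefix) suffix)) u∉)

  -- Prepending a step to a path either keeps it a path or closes a loop,
  -- which is cut out; balance makes the loop gain vanish.
  shortcut : ∀ {B v ss w} → Balanced B → IsWalk B v ss w →
             ∃[ ps ] IsPath B v ps w × gainOf ps ≡ gainOf ss
  shortcut bal nil = [] , (nil , [] ∷ []) , refl
  shortcut bal (cons {s = s} {ss = ss} e∈ refl wk) with shortcut bal wk
  ... | ps , path@(wp , vs!) , ps≈ss with from s VertexList.∈? map to ps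
  ...   | no v∉  = s ∷ ps , (cons e∈ refl wp , (from≢to s ∷ ¬Any⇒All¬ _ v∉) ∷ vs!) ,
                   cong (λ g → stepGain s + g) ps≈ss
  ...   | yes v∈ = suffix , suffix-path , (begin
    gainOf suffix                               ≡⟨ ℤ.+-identityˡ _ ⟨
    + 0 + gainOf suffix                         ≡⟨ cong (_+ gainOf suffix) loop≡0 ⟨
    stepGain s + gainOf prefix + gainOf suffix  ≡⟨ ℤ.+-assoc (stepGain s) _ _ ⟩
    stepGain s + (gainOf prefix + gainOf suffix) ≡⟨ cong (λ g → stepGain s + g) split-gain ⟩
    stepGain s + gainOf ss                      ∎)
    where
    open ≡.≡-Reasoning
    open PathSplit (split-path path v∈)
    loop≡0 : stepGain s + gainOf prefix ≡ + 0
    loop≡0 = balanced-step-path {s = s} bal e∈ prefix-path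
    split-gain : gainOf prefix + gainOf suffix ≡ gainOf ss
    split-gain = trans (sym (trans (cong gainOf ps≡) (gainOf-++ prefix suffix))) ps≈ss

  balanced⇒closed-walk-gain≡0 : ∀ {B v ss} → Balanced B → IsWalk B v ss v → gainOf ss ≡ + 0
  balanced⇒closed-walk-gain≡0 bal wk with shortcut bal wk
  ... | ps , path , ps≈ss = trans (sym ps≈ss) (cong gainOf (closed-path-empty path))

  balanced⇒walk-gain-unique : ∀ {B a ps qs b} → Balanced B →
                              IsWalk B a ps b → IsWalk B a qs b → gainOf ps ≡ gainOf qs
  balanced⇒walk-gain-unique {ps = ps} {qs} bal wp wq = sym (x∙y⁻¹≈ε⇒x≈y _ _
    (trans (sym (gainOf-revAppend ps qs)) (balanced⇒closed-walk-gain≡0 bal (walk-revAppend wp wq))))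

  satisfies? : ∀ B x → Dec (Satisfies B x)
  satisfies? B x = allIn? (onHyp? x ∘ H) B

  unbalanced⇒no-solutions : ∀ {B} → ¬ Balanced B → ∀ xs → filter (satisfies? B) xs ≡ []
  unbalanced⇒no-solutions ¬bal xs =
    filter-none (satisfies? _) {xs} (All.tabulate (λ {x} _ → ¬bal ∘ satisfiable⇒balanced x))

  satisfies-resp-≋ : ∀ {B x y} → x ≋ y → Satisfies B x → Satisfies B y
  satisfies-resp-≋ x≋y x⊨B e e∈ =
    trans (sym (x≋y (tgt (H e)))) (trans (x⊨B e e∈) (cong (_+ gain (H e)) (x≋y (src (H e)))))

module BalancedCount {n m : ℕ} (H : Fin m → Hyp n) {B : Subset m}
                     (bal : GainGraph.Balanced H B) (C : GainGraph.Components H B) where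
  open GainGraph H
  open Walks H
  open Components C

  top-satisfies : ∀ x → Satisfies B x → ∀ v → x (top (comp v)) ≡ x v + φ v
  top-satisfies x x⊨B v with φ-gain v
  ... | _ , (wk , _) , ss≈φ = trans (walk-satisfies x x⊨B wk) (cong (λ g → x v + g) ss≈φ)

  edge-same-component : ∀ {e} → e ∈ₑ B → comp (src (H e)) ≡ comp (tgt (H e))
  edge-same-component {e} e∈ = Equivalence.from (comp-iff _ _)
    ((e , true) ∷ [] , cons e∈ refl nil , (distinct (H e) ∷ []) ∷ [] ∷ [])

  φ-edge : ∀ {e} → e ∈ₑ B → φ (src (H e)) ≡ gain (H e) + φ (tgt (H e))
  φ-edge {e} e∈ with φ-gain (src (H e)) | φ-gain (tgt (H e))
  ... | ps , (wp , _) , ps≈φ | qs , (wq , _) , qs≈φ = begin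
    φ (src (H e))              ≡⟨ ps≈φ ⟨
    gainOf ps                  ≡⟨ balanced⇒walk-gain-unique bal wp (cons {s = e , true} e∈ refl wq′) ⟩
    gain (H e) + gainOf qs     ≡⟨ cong (λ g → gain (H e) + g) qs≈φ ⟩
    gain (H e) + φ (tgt (H e)) ∎
    where
    open ≡.≡-Reasoning
    wq′ : IsWalk B (tgt (H e)) qs (top (comp (src (H e))))
    wq′ = subst (λ k → IsWalk B (tgt (H e)) qs (top k)) (sym (edge-same-component e∈)) wq

  module _ (L : Fin n → List ℤ) (L! : ∀ i → Unique (L i)) where

    component : Fin c → List (Fin n)
    component k = filter (λ v → comp v ≟ k) (allFin n)

    topValues : Fin c → List ℤ
    topValues k = ⋂ (map (λ v → L v ⊕ φ v) (component k))

    ∈-topValues⁺ : ∀ {k z} → (∀ v → comp v ≡ k → z ∈ L v ⊕ φ v) → z ∈ topValues k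
    ∈-topValues⁺ {k} z∈ = ∈-⋂⁺ (∈-map⁺ _ (∈-filter⁺ _ (∈-allFin (top k)) (top-in k)))
      (All.map⁺ (All.map (λ {v} → z∈ v) (All.all-filter _ (allFin n))))

    ∈-topValues⁻ : ∀ {k z v} → z ∈ topValues k → comp v ≡ k → z ∈ L v ⊕ φ v
    ∈-topValues⁻ {k} {v = v} z∈ v∈k =
      All.lookup (All.map⁻ (∈-⋂⁻ _ z∈)) (∈-filter⁺ _ (∈-allFin v) v∈k)

    topValues-unique : ∀ k → Unique (topValues k)
    topValues-unique k =
      ⋂-unique (All.map⁺ {xs = component k} (All.tabulate (λ {v} _ → ⊕-unique (φ v) (L! v))))

    Solution : Pred (Fin n → ℤ) 0ℓ
    Solution x = Satisfies B x × (∀ i → x i ∈ L i)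

    restrict : (Fin n → ℤ) → (Fin c → ℤ)
    restrict x k = x (top k)

    extend : (Fin c → ℤ) → (Fin n → ℤ)
    extend w v = w (comp v) - φ v

    restrict-injective : ∀ {x y} → Solution x → Solution y → restrict x ≋ restrict y → x ≋ y
    restrict-injective {x} {y} (x⊨B , _) (y⊨B , _) x≋y v = begin
      x v                       ≡⟨ x≈z//y _ _ _ (sym (top-satisfies x x⊨B v)) ⟩
      x (top (comp v)) - φ v    ≡⟨ cong (_- φ v) (x≋y (comp v)) ⟩
      y (top (comp v)) - φ v    ≡⟨ x≈z//y _ _ _ (sym (top-satisfies y y⊨B v)) ⟨
      y v                       ∎
      where open ≡.≡-Reasoning

    restrict-∈ : ∀ {x} → Solution x → Any (restrict x ≋_) (points c topValues)
    restrict-∈ {x} (x⊨B , x∈L) = ∈-points⁺ c topValues (λ k → ∈-topValues⁺ (λ v v∈k →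
      subst (λ k → x (top k) ∈ L v ⊕ φ v) v∈k
        (subst (_∈ L v ⊕ φ v) (sym (top-satisfies x x⊨B v)) (∈-map⁺ (_+ φ v) (x∈L v)))))

    extend-injective : ∀ {w w′} → extend w ≋ extend w′ → w ≋ w′
    extend-injective w≋w′ k with comp-sur k
    ... | v , refl = ∙-cancelʳ (- φ v) _ _ (w≋w′ v)

    extend-solution : ∀ {w} → (∀ k → w k ∈ topValues k) → Solution (extend w)
    extend-solution {w} w∈T = extend-satisfies , extend-∈
      where
      extend-satisfies : Satisfies B (extend w)
      extend-satisfies e e∈ = begin
        w (comp b) - φ b                    ≡⟨ regroup (w (comp b)) (gain (H e)) (φ b) ⟩
        w (comp b) - (gain (H e) + φ b) + gain (H e)
          ≡⟨ cong₂ (λ k g → w k - g + gain (H e)) (sym (edge-same-component e∈)) (sym (φ-edge e∈)) ⟩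
        w (comp a) - φ a + gain (H e)       ∎
        where
        open ≡.≡-Reasoning
        a = src (H e)
        b = tgt (H e)
        regroup : ∀ x g p → x - p ≡ x - (g + p) + g
        regroup = solve-∀
      extend-∈ : ∀ v → extend w v ∈ L v
      extend-∈ v with ∈-map⁻ (_+ φ v) (∈-topValues⁻ (w∈T (comp v)) refl)
      ... | z , z∈ , w≡z+φ = subst (_∈ L v) (x≈z//y _ _ _ (sym w≡z+φ)) z∈

    solutions : List (Fin n → ℤ)
    solutions = filter (satisfies? B) (points n L)

    solutions-count : length solutions ≡ componentProduct H L C
    solutions-count = begin
      length solutions                        ≡⟨ ℕ.≤-antisym solutions≤ solutions≥ ⟩
      length (points c topValues)             ≡⟨ length-points c topValues ⟩
      product (tabulate (length ∘ topValues)) ≡⟨ cong product (map-tabulate id (length ∘ topValues)) ⟨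
      componentProduct H L C                  ∎
      where
      open ≡.≡-Reasoning
      points-∈ : ∀ k (M : Fin k → List ℤ) → All (λ x → ∀ i → x i ∈ M i) (points k M)
      points-∈ k M = All.tabulate (∈-points⁻ k M ∘ Any.map ≋-reflexive)
      solutions≤ : length solutions ℕ.≤ length (points c topValues)
      solutions≤ = length≤-injectiveOn (≋-setoid n) (≋-setoid c) restrict restrict-injective
        (UniqueSetoid.filter⁺ (≋-setoid n) (satisfies? B) (points-unique n L L!))
        (All.zip (All.all-filter _ (points n L) , All.filter⁺ _ (points-∈ n L)))
        restrict-∈
      solutions≥ : length (points c topValues) ℕ.≤ length solutions
      solutions≥ = length≤-injectiveOn (≋-setoid c) (≋-setoid n) extend (λ _ _ → extend-injective)
        (points-unique c topValues topValues-unique) (points-∈ c topValues)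
        (λ w∈T → let x⊨B , x∈L = extend-solution w∈T in
          Membershipₚ.∈-filter⁺ (≋-setoid n) (satisfies? B) satisfies-resp-≋ (∈-points⁺ n L x∈L) x⊨B)

module _ {n m : ℕ} (H : Fin m → Hyp n) where
  open Walks H

  avoiding-count : ∀ xs →
    + length (filter (λ x → all? (λ e → ¬? (onHyp? x (H e)))) xs)
      ≡ sumℤ (map (λ B → sign B * + length (filter (satisfies? B) xs)) (subsets m))
  avoiding-count []       = sym (sumℤ-map-zero (λ B → ℤ.*-zeroʳ (sign B)) (subsets m))
  avoiding-count (x ∷ xs) = begin
    + length (filter avoids? (x ∷ xs))
      ≡⟨ cong +_ (length-filter-∷ avoids? x xs) ⟩
    + (indicator (avoids? x) ℕ.+ length (filter avoids? xs))
      ≡⟨ ℤ.pos-+ (indicator (avoids? x)) _ ⟩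
    + indicator (avoids? x) + + length (filter avoids? xs)
      ≡⟨ cong₂ _+_ (sym (alternating-sum m (onHyp? x ∘ H))) (avoiding-count xs) ⟩
    sumℤ (map at-x (subsets m)) + sumℤ (map in-xs (subsets m))
      ≡⟨ sumℤ-map-+ at-x in-xs (subsets m) ⟨
    sumℤ (map (λ B → at-x B + in-xs B) (subsets m))
      ≡⟨ cong sumℤ (map-cong per-subset (subsets m)) ⟩
    sumℤ (map (λ B → sign B * + length (filter (satisfies? B) (x ∷ xs))) (subsets m)) ∎
    where
    open ≡.≡-Reasoning
    avoids? : ∀ y → Dec (∀ e → ¬ OnHyp y (H e))
    avoids? y = all? (λ e → ¬? (onHyp? y (H e)))
    at-x in-xs : Subset m → ℤ
    at-x  B = sign B * + indicator (satisfies? B x)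
    in-xs B = sign B * + length (filter (satisfies? B) xs)
    per-subset : ∀ B → at-x B + in-xs B ≡ sign B * + length (filter (satisfies? B) (x ∷ xs))
    per-subset B = sym (begin
      sign B * + length (filter (satisfies? B) (x ∷ xs))
        ≡⟨ cong (λ k → sign B * + k) (length-filter-∷ (satisfies? B) x xs) ⟩
      sign B * + (indicator (satisfies? B x) ℕ.+ length (filter (satisfies? B) xs))
        ≡⟨ cong (sign B *_) (ℤ.pos-+ (indicator (satisfies? B x)) _) ⟩
      sign B * (+ indicator (satisfies? B x) + + length (filter (satisfies? B) xs))
        ≡⟨ ℤ.*-distribˡ-+ (sign B) _ _ ⟩
      at-x B + in-xs B ∎)

  -- rhs sums a function defined locally by `with`; this names it.
  rhs-as-sum : ∀ L bal? D → Σ[ f ∈ (Subset m → ℤ) ] rhs H L bal? D ≡ sumℤ (map f (subsets m))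
  rhs-as-sum L bal? D = _ , refl

  summand-count : ∀ L → (∀ i → Unique (L i)) → ∀ bal? D B →
    sign B * + length (filter (satisfies? B) (points n L)) ≡ proj₁ (rhs-as-sum L bal? D) B
  summand-count L L! bal? D B with bal? B
  ... | yes bal = cong (λ k → sign B * + k) (BalancedCount.solutions-count H bal (D B bal) L L!)
  ... | no ¬bal = trans
    (cong (λ xs → sign B * + length xs) (unbalanced⇒no-solutions ¬bal (points n L)))
    (ℤ.*-zeroʳ (sign B))

-- The hyperplanes need not be distinct: inclusion–exclusion runs over edges.
theorem5p20 : (n m : ℕ) (H : Fin m → Hyp n) →
    (∀ e f → SameHyp (H e) (H f) → e ≡ f) →
    (L : Fin n → List ℤ) → (∀ i → Unique (L i)) →
    (bal? : ∀ B → Dec (GainGraph.Balanced H B)) →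
    (D : ∀ B → GainGraph.Balanced H B → GainGraph.Components H B) →
    + count H L ≡ rhs H L bal? D
theorem5p20 n m H _ L L! bal? D = begin
  + count H L
    ≡⟨ avoiding-count H (points n L) ⟩
  sumℤ (map (λ B → sign B * + length (filter (satisfies? B) (points n L))) (subsets m))
    ≡⟨ cong sumℤ (map-cong (summand-count H L L! bal? D) (subsets m)) ⟩
  sumℤ (map (proj₁ (rhs-as-sum H L bal? D)) (subsets m))
    ≡⟨ proj₂ (rhs-as-sum H L bal? D) ⟨
  rhs H L bal? D ∎
  where
  open ≡.≡-Reasoning
  open Walks H
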